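{- Let $H$ be a finite simple graph, $n$ a positive integer, and $k=|H|-\alpha(H)$. Then $$\chi_{\rho}(P_n\circ H) \leq n|H|-\left \lceil \frac{n}{2} \right \rceil \alpha{(H)}-\sum_{i=2}^{k+1}\left \lceil \frac{n}{i+1} \right \rceil- \sum_{j=k+2}^{|H|+1} \left ( \left \lfloor \frac{\left \lfloor \frac{n}{2} \right \rfloor -1}{\left \lfloor \frac{j}{2} \right \rfloor +1} \right \rfloor + 1 \right ) + |H|+1.$$
   Context: $P_n$ is the path on $n$ vertices, $|H|$ is the number of vertices of $H$ and $\alpha(H)$ its independence number. A $k$-packing coloring of a graph is a map $c:V\to\{1,\dots,k\}$ such that two distinct vertices with $c(u)=c(v)=i$ are at distance more than $i$; the packing chromatic number $\chi_\rho$ is the least such $k$. The lexicographic product $G\circ H$ has vertex set $V(G)\times V(H)$, with $(g_1,h_1)\sim(g_2,h_2)$ iff $g_1g_2\in E(G)$, or $g_1=g_2$ and $h_1h_2\in E(H)$. -}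

module Defs where

open import Data.Nat as ℕ using (ℕ; zero; suc; _+_; _*_; _∸_; _≤_; ⌈_/2⌉; ⌊_/2⌋)
import Data.Nat.DivMod as ℕD
open import Data.Integer as ℤ using (ℤ; +_; _/ℕ_)
open import Data.Fin using (Fin; toℕ; _≟_)
open import Data.Fin.Subset using (Subset; _∈_; ∣_∣)
open import Data.Bool using (Bool; true; false; _∨_; _∧_)
open import Data.List using (List; map; upTo; sum)
open import Data.Product using (Σ; _×_; _,_)
open import Relation.Nullary using (¬_)
open import Relation.Nullary.Decidable using (⌊_⌋)
open import Relation.Binary.PropositionalEquality using (_≡_; _≢_)

record SimpleGraph (V : Set) : Set where
  field
    adj     : V → V → Bool
    adj-sym : ∀ u v → adj u v ≡ adj v u
    adj-irrefl : ∀ v → adj v v ≡ false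
open SimpleGraph public

data Walk {V : Set} (G : SimpleGraph V) : V → V → ℕ → Set where
  here : ∀ {u} → Walk G u u 0
  step : ∀ {u w v ℓ} → adj G u w ≡ true → Walk G w v ℓ → Walk G u v (suc ℓ)

DistLe : {V : Set} → SimpleGraph V → V → V → ℕ → Set
DistLe G u v d = Σ ℕ (λ ℓ → ℓ ≤ d × Walk G u v ℓ)

IsPackingColoring : {V : Set} → SimpleGraph V → ℕ → (V → ℕ) → Set
IsPackingColoring G k c =
  (∀ v → 1 ≤ c v × c v ≤ k) ×
  (∀ u v → u ≢ v → c u ≡ c v → ¬ DistLe G u v (c u))

HasPackingColoring : {V : Set} → SimpleGraph V → ℕ → Set
HasPackingColoring G k = Σ (_ → ℕ) (IsPackingColoring G k)

IsPackingChromaticNumber : {V : Set} → SimpleGraph V → ℕ → Set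
IsPackingChromaticNumber G χ =
  HasPackingColoring G χ × (∀ k → HasPackingColoring G k → χ ≤ k)

IsIndependent : ∀ {m} → SimpleGraph (Fin m) → Subset m → Set
IsIndependent H S = ∀ u v → u ∈ S → v ∈ S → adj H u v ≡ false

IsIndependenceNumber : ∀ {m} → SimpleGraph (Fin m) → ℕ → Set
IsIndependenceNumber H a =
  Σ (Subset _) (λ S → IsIndependent H S × ∣ S ∣ ≡ a) ×
  (∀ S → IsIndependent H S → ∣ S ∣ ≤ a)

Path : (n : ℕ) → SimpleGraph (Fin n)
Path n = record { adj = a ; adj-sym = s ; adj-irrefl = ir }
  where
  a : Fin n → Fin n → Bool
  a i j = (suc (toℕ i) ℕ.≡ᵇ toℕ j) ∨ (suc (toℕ j) ℕ.≡ᵇ toℕ i)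
  s : ∀ u v → a u v ≡ a v u
  s u v with suc (toℕ u) ℕ.≡ᵇ toℕ v | suc (toℕ v) ℕ.≡ᵇ toℕ u
  ... | false | false = _≡_.refl
  ... | false | true  = _≡_.refl
  ... | true  | false = _≡_.refl
  ... | true  | true  = _≡_.refl
  noSelf : ∀ x → (suc x ℕ.≡ᵇ x) ≡ false
  noSelf zero = _≡_.refl
  noSelf (suc x) = noSelf x
  ir : ∀ v → a v v ≡ false
  ir v rewrite noSelf (toℕ v) = _≡_.refl

lexAdj : ∀ {n m} → SimpleGraph (Fin n) → SimpleGraph (Fin m) →
         Fin n × Fin m → Fin n × Fin m → Bool
lexAdj G H (g₁ , h₁) (g₂ , h₂) = adj G g₁ g₂ ∨ (⌊ g₁ ≟ g₂ ⌋ ∧ adj H h₁ h₂)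

Lex : ∀ {n m} → SimpleGraph (Fin n) → SimpleGraph (Fin m) →
      SimpleGraph (Fin n × Fin m)
Lex {n} {m} G H = record { adj = lexAdj G H ; adj-sym = s ; adj-irrefl = ir }
  where
  open import Relation.Binary.PropositionalEquality using (refl; cong₂; sym)
  open import Relation.Nullary using (yes; no)
  s : ∀ u v → lexAdj G H u v ≡ lexAdj G H v u
  s (g₁ , h₁) (g₂ , h₂) with g₁ ≟ g₂ | g₂ ≟ g₁
  ... | yes p | yes q = cong₂ _∨_ (adj-sym G g₁ g₂) (adj-sym H h₁ h₂)
  ... | yes p | no q = Data.Empty.⊥-elim (q (sym p)) where import Data.Empty
  ... | no p | yes q = Data.Empty.⊥-elim (p (sym q)) where import Data.Empty
  ... | no p | no q = cong₂ _∨_ (adj-sym G g₁ g₂) refl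
  ir : ∀ v → lexAdj G H v v ≡ false
  ir (g , h) rewrite adj-irrefl G g | adj-irrefl H h with ⌊ g ≟ g ⌋
  ... | false = refl
  ... | true = refl

-- ⌈ a / (suc b) ⌉ on naturals
ceilDiv : ℕ → (b : ℕ) → ℕ
ceilDiv a b = (a + b) ℕD./ suc b

-- Σ_{i=lo}^{hi} f i  (empty if hi < lo)
sumFromTo : ℕ → ℕ → (ℕ → ℤ) → ℤ
sumFromTo lo hi f = Data.List.foldr ℤ._+_ (+ 0) (map (λ t → f (lo + t)) (upTo (suc hi ∸ lo)))
  where import Data.List

bound : (n m a : ℕ) → ℤ
bound n m a =
  let k = m ∸ a in
  + (n * m) ℤ.- + (⌈ n /2⌉ * a)
  ℤ.- sumFromTo 2 (k + 1) (λ i → + ceilDiv n i)          -- ⌈ n / (i+1) ⌉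
  ℤ.- sumFromTo (k + 2) (m + 1)
        (λ j → ((+ ⌊ n /2⌋ ℤ.- + 1) /ℕ suc ⌊ j /2⌋) ℤ.+ + 1)
  ℤ.+ + m ℤ.+ + 1

-- Let S be an independent set of H of size α(H) and list the vertices of H so that the
-- k = |H| − α(H) vertices outside S come first; the vertex at position p (counted from 0)
-- owns the column of P_n ∘ H above it. A walk of length d changes the layer by at most d, so
-- vertices in layers more than d apart are at distance more than d.
-- A vertex outside S reuses colour p + 2 on the layers divisible by p + 3. A vertex of S
-- gets colour 1 on every even layer (these vertices are pairwise at distance at least 2 since
-- S is independent) and reuses colour p + 2 on the odd layers 2t + 1 with t divisible by
-- ⌊(p + 2)/2⌋ + 1, which are more than p + 2 apart. Every other vertex gets a colour of its
-- own above |H| + 1. Per column there are n − ⌈n/(p + 3)⌉, resp.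
-- ⌊n/2⌋ − ⌈⌊n/2⌋/(⌊(p + 2)/2⌋ + 1)⌉, of them, and adding up gives exactly the bound.

module Submission where

open import Data.Bool using (Bool; true; false; if_then_else_; T)
open import Data.Bool.Properties using (∧-zeroʳ)
open import Data.Empty using (⊥-elim)
open import Data.Fin as Fin using (Fin; zero; suc; toℕ)
open import Data.Fin.Properties using (toℕ-injective; toℕ<n)
open import Data.Fin.Subset using (Subset; ∣_∣; _∈_)
open import Data.Integer as ℤ using (ℤ; +≤+)
open import Data.Integer.Tactic.RingSolver using (solve-∀)
open import Data.List using ([]; _∷_; map; foldr; applyUpTo; upTo)
open import Data.List.Properties using (map-upTo)
open import Data.Nat
open import Data.Nat.Properties
open import Data.Nat.DivMod
open import Data.Nat.Divisibility
open import Data.Product using (_×_; _,_; proj₁)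
open import Data.Sum using (inj₁; inj₂)
open import Data.Vec using (Vec; []; _∷_; lookup)
open import Data.Vec.Properties using (lookup⇒[]=)
open import Function using (_∘_)
open import Relation.Nullary using (¬_; yes; no; does)
open import Relation.Nullary.Decidable using (dec-true; dec-false)
open import Relation.Binary using (tri<; tri≈; tri>)
open import Relation.Binary.PropositionalEquality
open import Algebra.Properties.CommutativeSemigroup +-commutativeSemigroup
  using () renaming (interchange to +-interchange)
open import Defs

∑ : (ℕ → ℕ) → ℕ → ℕ
∑ f zero    = 0
∑ f (suc n) = ∑ f n + f n

∑-cong : ∀ {f g} n → (∀ t → t < n → f t ≡ g t) → ∑ f n ≡ ∑ g n
∑-cong zero    _   = refl
∑-cong (suc n) f≗g = cong₂ _+_ (∑-cong n (λ t t<n → f≗g t (m<n⇒m<1+n t<n))) (f≗g n ≤-refl)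

∑-distrib-+ : ∀ f g n → ∑ (λ t → f t + g t) n ≡ ∑ f n + ∑ g n
∑-distrib-+ f g zero    = refl
∑-distrib-+ f g (suc n) =
  trans (cong (_+ (f n + g n)) (∑-distrib-+ f g n)) (+-interchange (∑ f n) (∑ g n) (f n) (g n))

∑-const : ∀ c n → ∑ (λ _ → c) n ≡ n * c
∑-const c zero    = refl
∑-const c (suc n) = trans (cong (_+ c) (∑-const c n)) (+-comm (n * c) c)

∑-split : ∀ f k a → ∑ f (k + a) ≡ ∑ f k + ∑ (λ t → f (k + t)) a
∑-split f k zero    = trans (cong (∑ f) (+-identityʳ k)) (sym (+-identityʳ (∑ f k)))
∑-split f k (suc a) = begin
  ∑ f (k + suc a)                                ≡⟨ cong (∑ f) (+-suc k a) ⟩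
  ∑ f (k + a) + f (k + a)                        ≡⟨ cong (_+ f (k + a)) (∑-split f k a) ⟩
  ∑ f k + ∑ (λ t → f (k + t)) a + f (k + a)      ≡⟨ +-assoc (∑ f k) _ (f (k + a)) ⟩
  ∑ f k + ∑ (λ t → f (k + t)) (suc a)            ∎
  where open ≡-Reasoning

∑-suc : ∀ f n → ∑ f (suc n) ≡ f 0 + ∑ (f ∘ suc) n
∑-suc f zero    = +-comm 0 (f 0)
∑-suc f (suc n) = trans (cong (_+ f (suc n)) (∑-suc f n)) (+-assoc (f 0) (∑ (f ∘ suc) n) (f (suc n)))

foldr-+-applyUpTo : ∀ f n → foldr _+_ 0 (applyUpTo f n) ≡ ∑ f n
foldr-+-applyUpTo f zero    = refl
foldr-+-applyUpTo f (suc n) = trans (cong (f 0 +_) (foldr-+-applyUpTo (f ∘ suc) n)) (sym (∑-suc f n))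

∑-mono-≤ : ∀ f {p q} → p ≤ q → ∑ f p ≤ ∑ f q
∑-mono-≤ f {p} p≤q with m≤n⇒∃[o]m+o≡n p≤q
... | o , refl = subst (_≤ ∑ f (p + o)) (+-identityʳ (∑ f p))
                   (subst (∑ f p + 0 ≤_) (sym (∑-split f p o)) (+-monoʳ-≤ (∑ f p) z≤n))

∑+<∑ : ∀ f {p q r} → p < q → r < f p → ∑ f p + r < ∑ f q
∑+<∑ f p<q r<fp = <-≤-trans (+-monoʳ-< _ r<fp) (∑-mono-≤ f p<q)

∑+-injective : ∀ f {p p' r r'} → r < f p → r' < f p' → ∑ f p + r ≡ ∑ f p' + r' → p ≡ p'
∑+-injective f {p} {p'} r<fp r'<fp' eq with <-cmp p p'
... | tri< p<p' _ _ = ⊥-elim (<-irrefl eq (<-≤-trans (∑+<∑ f p<p' r<fp) (m≤m+n _ _)))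
... | tri≈ _ p≡p' _ = p≡p'
... | tri> _ _ p>p' = ⊥-elim (<-irrefl (sym eq) (<-≤-trans (∑+<∑ f p>p' r'<fp') (m≤m+n _ _)))

ceilDiv-zero : ∀ e → ceilDiv 0 e ≡ 0
ceilDiv-zero e = m<n⇒m/n≡0 (n<1+n e)

ceilDiv-suc-∣ : ∀ g e → suc e ∣ g → ceilDiv (suc g) e ≡ suc (ceilDiv g e)
ceilDiv-suc-∣ g e D∣g = begin
  suc (g + e) / D       ≡⟨ /-congˡ (+-suc g e) ⟨
  (g + D) / D           ≡⟨ +-distrib-/-∣ˡ D D∣g ⟩
  g / D + D / D         ≡⟨ cong₂ _+_ g/D≡ceilDiv (n/n≡1 D) ⟩
  ceilDiv g e + 1       ≡⟨ +-comm (ceilDiv g e) 1 ⟩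
  suc (ceilDiv g e)     ∎
  where
  open ≡-Reasoning
  D : ℕ
  D = suc e
  g/D≡ceilDiv : g / D ≡ ceilDiv g e
  g/D≡ceilDiv = sym (trans (+-distrib-/-∣ˡ e D∣g) (trans (cong (g / D +_) (m<n⇒m/n≡0 (n<1+n e))) (+-identityʳ _)))

ceilDiv-suc-∤ : ∀ g e → ¬ suc e ∣ g → ceilDiv (suc g) e ≡ ceilDiv g e
ceilDiv-suc-∤ g zero      1∤g = ⊥-elim (1∤g (1∣ g))
ceilDiv-suc-∤ g e@(suc _) D∤g = begin
  suc (g + e) / D         ≡⟨ /-congˡ (+-comm 1 (g + e)) ⟩
  (g + e + 1) / D         ≡⟨ +-distrib-/ (g + e) 1 (subst (λ x → r + x < D) (sym (m<n⇒m%n≡m 1<D)) r+1<D) ⟩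
  (g + e) / D + 1 / D     ≡⟨ cong ((g + e) / D +_) (m<n⇒m/n≡0 1<D) ⟩
  (g + e) / D + 0         ≡⟨ +-identityʳ _ ⟩
  (g + e) / D             ∎
  where
  open ≡-Reasoning
  D : ℕ
  D = suc e
  r : ℕ
  r = (g + e) % D
  1<D : 1 < D
  1<D = s≤s (s≤s z≤n)
  r≢e : r ≢ e
  r≢e r≡e = D∤g (divides ((g + e) / D) (+-cancelʳ-≡ e g ((g + e) / D * D) (begin
    g + e                   ≡⟨ m≡m%n+[m/n]*n (g + e) D ⟩
    r + (g + e) / D * D     ≡⟨ cong (_+ (g + e) / D * D) r≡e ⟩
    e + (g + e) / D * D     ≡⟨ +-comm e _ ⟩
    (g + e) / D * D + e     ∎)))
  r+1<D : r + 1 < D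
  r+1<D = subst (_< D) (+-comm 1 r) (s≤s (≤∧≢⇒< (s≤s⁻¹ (m%n<n (g + e) D)) r≢e))

nonMultiples : ℕ → ℕ → ℕ
nonMultiples e zero    = 0
nonMultiples e (suc g) with suc e ∣? g
... | yes _ = nonMultiples e g
... | no  _ = suc (nonMultiples e g)

nonMultiples+ceilDiv : ∀ e g → nonMultiples e g + ceilDiv g e ≡ g
nonMultiples+ceilDiv e zero = ceilDiv-zero e
nonMultiples+ceilDiv e (suc g) with suc e ∣? g
... | yes D∣g = trans (cong (nonMultiples e g +_) (ceilDiv-suc-∣ g e D∣g))
                  (trans (+-suc (nonMultiples e g) _) (cong suc (nonMultiples+ceilDiv e g)))
... | no  D∤g = cong suc (trans (cong (nonMultiples e g +_) (ceilDiv-suc-∤ g e D∤g)) (nonMultiples+ceilDiv e g))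

nonMultiples-mono-≤ : ∀ e {g g'} → g ≤ g' → nonMultiples e g ≤ nonMultiples e g'
nonMultiples-mono-≤ e g≤g' = mono (≤⇒≤′ g≤g')
  where
  grows : ∀ g → nonMultiples e g ≤ nonMultiples e (suc g)
  grows g with suc e ∣? g
  ... | yes _ = ≤-refl
  ... | no  _ = n≤1+n _
  mono : ∀ {g g'} → g ≤′ g' → nonMultiples e g ≤ nonMultiples e g'
  mono ≤′-refl           = ≤-refl
  mono (≤′-step {n = g'} g≤′g') = ≤-trans (mono g≤′g') (grows g')

nonMultiples-< : ∀ e {x g} → x < g → ¬ suc e ∣ x → nonMultiples e x < nonMultiples e g
nonMultiples-< e {x} x<g D∤x = ≤-trans counted (nonMultiples-mono-≤ e x<g)
  where
  counted : nonMultiples e x < nonMultiples e (suc x)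
  counted with suc e ∣? x
  ... | yes D∣x = ⊥-elim (D∤x D∣x)
  ... | no  _   = ≤-refl

nonMultiples-injective : ∀ e {x y} → ¬ suc e ∣ x → ¬ suc e ∣ y →
                         nonMultiples e x ≡ nonMultiples e y → x ≡ y
nonMultiples-injective e {x} {y} D∤x D∤y eq with <-cmp x y
... | tri< x<y _ _ = ⊥-elim (<-irrefl eq (nonMultiples-< e x<y D∤x))
... | tri≈ _ x≡y _ = x≡y
... | tri> _ _ x>y = ⊥-elim (<-irrefl (sym eq) (nonMultiples-< e x>y D∤y))

multiple-gap : ∀ {d x y} → x ≤ y → d ∣ x → d ∣ y → x ≢ y → d ≤ y ∸ x
multiple-gap {d} {x} {y} x≤y d∣x d∣y x≢y = ∣⇒≤ {{>-nonZero (m<n⇒0<n∸m (≤∧≢⇒< x≤y x≢y))}} d∣y∸x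
  where
  d∣y∸x : d ∣ y ∸ x
  d∣y∸x = ∣m+n∣m⇒∣n (subst (d ∣_) (sym (m+[n∸m]≡n x≤y)) d∣y) d∣x

multiples-apart : ∀ {d x y} → d ∣ x → d ∣ y → x ≢ y → d ≤ ∣ x - y ∣
multiples-apart {d} {x} {y} d∣x d∣y x≢y with ≤-total x y
... | inj₁ x≤y = subst (d ≤_) (trans (sym (m≤n⇒∣n-m∣≡n∸m x≤y)) (∣-∣-comm y x)) (multiple-gap x≤y d∣x d∣y x≢y)
... | inj₂ y≤x = subst (d ≤_) (sym (m≤n⇒∣n-m∣≡n∸m y≤x)) (multiple-gap y≤x d∣y d∣x (x≢y ∘ sym))

-- Listing the positions of a Boolean vector with the false entries first

δ : Bool → Bool → ℕ
δ true  true  = 1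
δ false false = 1
δ true  false = 0
δ false true  = 0

δ-refl : ∀ b → δ b b ≡ 1
δ-refl true  = refl
δ-refl false = refl

count : ∀ {m} → Bool → Vec Bool m → ℕ
count b []      = 0
count b (x ∷ v) = δ x b + count b v

rank : ∀ {m} → Bool → Vec Bool m → Fin m → ℕ
rank b (x ∷ v) zero    = 0
rank b (x ∷ v) (suc h) = δ x b + rank b v h

∣∣≡count-true : ∀ {m} (v : Subset m) → ∣ v ∣ ≡ count true v
∣∣≡count-true []          = refl
∣∣≡count-true (true ∷ v)  = cong suc (∣∣≡count-true v)
∣∣≡count-true (false ∷ v) = ∣∣≡count-true v

count-false+count-true : ∀ {m} (v : Vec Bool m) → count false v + count true v ≡ m
count-false+count-true []          = refl
count-false+count-true (true ∷ v)  = trans (+-suc (count false v) _) (cong suc (count-false+count-true v))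
count-false+count-true (false ∷ v) = cong suc (count-false+count-true v)

rank<count : ∀ {m b} (v : Vec Bool m) h → lookup v h ≡ b → rank b v h < count b v
rank<count (x ∷ v) zero    refl = subst (_≤ δ x x + count x v) (δ-refl x) (m≤m+n _ _)
rank<count (x ∷ v) (suc h) vₕ≡b = +-monoʳ-< (δ x _) (rank<count v h vₕ≡b)

rank-injective : ∀ {m b} (v : Vec Bool m) {h h'} → lookup v h ≡ b → lookup v h' ≡ b →
                 rank b v h ≡ rank b v h' → h ≡ h'
rank-injective (x ∷ v) {zero}  {zero}   _    _     _  = refl
rank-injective (x ∷ v) {zero}  {suc h'} refl _     eq = ⊥-elim (0≢1+n (trans eq (cong (_+ rank x v h') (δ-refl x))))
rank-injective (x ∷ v) {suc h} {zero}   _    refl  eq = ⊥-elim (0≢1+n (trans (sym eq) (cong (_+ rank x v h) (δ-refl x))))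
rank-injective (x ∷ v) {suc h} {suc h'} vₕ≡b vₕ'≡b eq =
  cong suc (rank-injective v vₕ≡b vₕ'≡b (+-cancelˡ-≡ (δ x _) _ _ eq))

partitionIndex : ∀ {m} → Vec Bool m → Fin m → ℕ
partitionIndex v h = if lookup v h then count false v + rank true v h else rank false v h

partitionIndex-< : ∀ {m} (v : Vec Bool m) h → partitionIndex v h < m
partitionIndex-< v h with lookup v h in vₕ≡b
... | true  = subst (count false v + rank true v h <_) (count-false+count-true v)
                (+-monoʳ-< (count false v) (rank<count v h vₕ≡b))
... | false = <-≤-trans (rank<count v h vₕ≡b)
                (subst (count false v ≤_) (count-false+count-true v) (m≤m+n _ _))

partitionIndex-injective : ∀ {m} (v : Vec Bool m) {h h'} → partitionIndex v h ≡ partitionIndex v h' → h ≡ h'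
partitionIndex-injective v {h} {h'} eq with lookup v h in vₕ≡b | lookup v h' in vₕ'≡b'
... | true  | true  = rank-injective v vₕ≡b vₕ'≡b' (+-cancelˡ-≡ (count false v) _ _ eq)
... | false | false = rank-injective v vₕ≡b vₕ'≡b' eq
... | true  | false = ⊥-elim (m+n≮m _ _ (subst (_< count false v) (sym eq) (rank<count v h' vₕ'≡b')))
... | false | true  = ⊥-elim (m+n≮m _ _ (subst (_< count false v) eq (rank<count v h vₕ≡b)))

lookup≡partitionIndex≥count : ∀ {m} (v : Vec Bool m) h → lookup v h ≡ does (count false v ≤? partitionIndex v h)
lookup≡partitionIndex≥count v h with lookup v h in vₕ≡b
... | true  = sym (dec-true (count false v ≤? _) (m≤m+n (count false v) (rank true v h)))
... | false = sym (dec-false (count false v ≤? _) (<⇒≱ (rank<count v h vₕ≡b)))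

-- Layers and distances in the lexicographic product

OneLipschitz : {V : Set} → SimpleGraph V → (V → ℕ) → Set
OneLipschitz G f = ∀ u v → adj G u v ≡ true → ∣ f u - f v ∣ ≤ 1

walk-lipschitz : ∀ {V} {G : SimpleGraph V} (f : V → ℕ) → OneLipschitz G f →
                 ∀ {u v ℓ} → Walk G u v ℓ → ∣ f u - f v ∣ ≤ ℓ
walk-lipschitz f f-lip {u} here = ≤-reflexive (∣n-n∣≡0 (f u))
walk-lipschitz f f-lip (step {u} {w} {v} u~w w⇝v) =
  ≤-trans (∣-∣-triangle (f u) (f w) (f v)) (+-mono-≤ (f-lip u w u~w) (walk-lipschitz f f-lip w⇝v))

distLe-lipschitz : ∀ {V} {G : SimpleGraph V} (f : V → ℕ) → OneLipschitz G f →
                   ∀ {u v d} → DistLe G u v d → ∣ f u - f v ∣ ≤ d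
distLe-lipschitz f f-lip (ℓ , ℓ≤d , u⇝v) = ≤-trans (walk-lipschitz f f-lip u⇝v) ℓ≤d

1+m≡n⇒∣m-n∣≤1 : ∀ {m n} → suc m ≡ n → ∣ m - n ∣ ≤ 1
1+m≡n⇒∣m-n∣≤1 {m} refl = ≤-reflexive (trans (cong (∣ m -_∣) (+-comm 1 m)) (∣m-m+n∣≡n m 1))

path-lipschitz : ∀ N → OneLipschitz (Path N) toℕ
path-lipschitz N i j i~j with suc (toℕ i) ≡ᵇ toℕ j in i+1≡j | suc (toℕ j) ≡ᵇ toℕ i in j+1≡i
... | true  | _    = 1+m≡n⇒∣m-n∣≤1 (≡ᵇ⇒≡ (suc (toℕ i)) (toℕ j) (subst T (sym i+1≡j) _))
... | false | true = subst (_≤ 1) (∣-∣-comm (toℕ j) (toℕ i))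
                       (1+m≡n⇒∣m-n∣≤1 (≡ᵇ⇒≡ (suc (toℕ j)) (toℕ i) (subst T (sym j+1≡i) _)))
path-lipschitz N i j () | false | false

lex-lipschitz : ∀ {n m} (G : SimpleGraph (Fin n)) (H : SimpleGraph (Fin m)) (f : Fin n → ℕ) →
                OneLipschitz G f → OneLipschitz (Lex G H) (f ∘ proj₁)
lex-lipschitz G H f f-lip (g₁ , h₁) (g₂ , h₂) u~v with g₁ Fin.≟ g₂ | adj G g₁ g₂ in g₁~g₂
... | yes refl | _     = ≤-trans (≤-reflexive (∣n-n∣≡0 (f g₁))) z≤n
... | no _     | true  = f-lip g₁ g₂ g₁~g₂
lex-lipschitz G H f f-lip (g₁ , h₁) (g₂ , h₂) () | no _ | false

independent-apart : ∀ {n m} (G : SimpleGraph (Fin n)) (H : SimpleGraph (Fin m)) {g h h'} →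
                    h ≢ h' → adj H h h' ≡ false → ¬ DistLe (Lex G H) (g , h) (g , h') 1
independent-apart G H h≢h' h≁h' (0 , _ , here) = h≢h' refl
independent-apart G H {g} {h} {h'} h≢h' h≁h' (1 , _ , step u~v here) = true≢false (trans (sym u~v) nonadjacent)
  where
  true≢false : true ≢ false
  true≢false ()
  nonadjacent : lexAdj G H (g , h) (g , h') ≡ false
  nonadjacent rewrite adj-irrefl G g | h≁h' = ∧-zeroʳ _
independent-apart G H h≢h' h≁h' (suc (suc _) , s≤s () , _)

data EvenOdd (g : ℕ) : Set where
  even : ∀ x → g ≡ 2 * x → EvenOdd g
  odd  : ∀ x → g ≡ suc (2 * x) → EvenOdd g

evenOdd : ∀ g → EvenOdd g
evenOdd zero = even 0 refl
evenOdd (suc g) with evenOdd g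
... | even x g≡2x   = odd x (cong suc g≡2x)
... | odd  x g≡1+2x = even (suc x) (trans (cong suc g≡1+2x) (sym (*-suc 2 x)))

⌊2*n/2⌋≡n : ∀ n → ⌊ 2 * n /2⌋ ≡ n
⌊2*n/2⌋≡n n = trans (cong (λ m → ⌊ n + m /2⌋) (+-identityʳ n)) (sym (n≡⌊n+n/2⌋ n))

1+2*m<n⇒m<⌊n/2⌋ : ∀ {m n} → suc (2 * m) < n → m < ⌊ n /2⌋
1+2*m<n⇒m<⌊n/2⌋ {m} {n} 1+2m<n = subst (_≤ ⌊ n /2⌋) (cong suc (⌊2*n/2⌋≡n m)) (⌊n/2⌋-mono 1+2m<n)

n<2*suc⌊n/2⌋ : ∀ n → n < 2 * suc ⌊ n /2⌋
n<2*suc⌊n/2⌋ zero          = s≤s z≤n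
n<2*suc⌊n/2⌋ (suc zero)    = s≤s (s≤s z≤n)
n<2*suc⌊n/2⌋ (suc (suc n)) = subst (suc (suc n) <_) (sym (*-suc 2 (suc ⌊ n /2⌋))) (s≤s (s≤s (n<2*suc⌊n/2⌋ n)))

-- In a column of kind b (false outside S, true in S) at position p, slot x lies in layer
-- slotLayer b x, and colour p + 2 is reused on the slots divisible by suc (period b p).
period : Bool → ℕ → ℕ
period false p = suc (suc p)
period true  p = ⌊ suc (suc p) /2⌋

slotLayer : Bool → ℕ → ℕ
slotLayer false x = x
slotLayer true  x = suc (2 * x)

slots : ℕ → Bool → ℕ
slots N false = N
slots N true  = ⌊ N /2⌋

slotLayer-< : ∀ N b {x} → slotLayer b x < N → x < slots N b
slotLayer-< N false x<N    = x<N
slotLayer-< N true  1+2x<N = 1+2*m<n⇒m<⌊n/2⌋ 1+2x<N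

slotLayer-apart : ∀ b p {x y} → suc (period b p) ∣ x → suc (period b p) ∣ y → x ≢ y →
                  suc (suc p) < ∣ slotLayer b x - slotLayer b y ∣
slotLayer-apart false p D∣x D∣y x≢y = multiples-apart D∣x D∣y x≢y
slotLayer-apart true  p {x} {y} D∣x D∣y x≢y = begin-strict
  suc (suc p)               <⟨ n<2*suc⌊n/2⌋ (suc (suc p)) ⟩
  2 * suc (period true p)   ≤⟨ *-monoʳ-≤ 2 (multiples-apart D∣x D∣y x≢y) ⟩
  2 * ∣ x - y ∣              ≡⟨ *-distribˡ-∣-∣ 2 x y ⟩
  ∣ 2 * x - 2 * y ∣          ∎
  where open ≤-Reasoning

-- The colouring

columnUniques : ℕ → ℕ → ℕ → ℕ
columnUniques N k p = let b = does (k ≤? p) in nonMultiples (period b p) (slots N b)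

module LexPathColouring {m} (H : SimpleGraph (Fin m)) (S : Subset m)
                        (S-independent : IsIndependent H S) (N : ℕ) where

  k : ℕ
  k = count false S

  position : Fin m → ℕ
  position = partitionIndex S

  inS : ℕ → Bool
  inS p = does (k ≤? p)

  inS-position : ∀ h → lookup S h ≡ inS (position h)
  inS-position = lookup≡partitionIndex≥count S

  position-< : ∀ h → position h < m
  position-< = partitionIndex-< S

  periodAt : ℕ → ℕ
  periodAt p = period (inS p) p

  uniques : ℕ → ℕ
  uniques = columnUniques N k

  colours : ℕ
  colours = suc (m + ∑ uniques m)

  uniqueColour : ℕ → ℕ → ℕ
  uniqueColour p r = suc (suc (m + (∑ uniques p + r)))

  slotColour : ℕ → ℕ → ℕ
  slotColour p x with suc (periodAt p) ∣? x
  ... | yes _ = suc (suc p)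
  ... | no  _ = uniqueColour p (nonMultiples (periodAt p) x)

  layerColour : Bool → ℕ → ℕ → ℕ
  layerColour false p g = slotColour p g
  layerColour true  p g with evenOdd g
  ... | even _ _ = 1
  ... | odd  x _ = slotColour p x

  colour : Fin N × Fin m → ℕ
  colour (g , h) = layerColour (inS (position h)) (position h) (toℕ g)

  data ColourView (p g c : ℕ) : Set where
    one    : inS p ≡ true → ∀ x → g ≡ 2 * x → c ≡ 1 → ColourView p g c
    class  : ∀ x → g ≡ slotLayer (inS p) x → suc (periodAt p) ∣ x →
             c ≡ suc (suc p) → ColourView p g c
    unique : ∀ x → g ≡ slotLayer (inS p) x → ¬ suc (periodAt p) ∣ x →
             c ≡ uniqueColour p (nonMultiples (periodAt p) x) → ColourView p g c

  slotColourView : ∀ p g x → g ≡ slotLayer (inS p) x → ColourView p g (slotColour p x)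
  slotColourView p g x g≡ with suc (periodAt p) ∣? x
  ... | yes D∣x = class x g≡ D∣x refl
  ... | no  D∤x = unique x g≡ D∤x refl

  colourView : ∀ p g → ColourView p g (layerColour (inS p) p g)
  colourView p g = byKind (inS p) refl
    where
    byKind : ∀ b → inS p ≡ b → ColourView p g (layerColour b p g)
    byKind false inS≡false = slotColourView p g g (cong (λ b → slotLayer b g) (sym inS≡false))
    byKind true  inS≡true with evenOdd g
    ... | even x g≡2x   = one inS≡true x g≡2x refl
    ... | odd  x g≡1+2x = slotColourView p g x (trans g≡1+2x (cong (λ b → slotLayer b x) (sym inS≡true)))

  G : SimpleGraph (Fin N × Fin m)
  G = Lex (Path N) H

  layer-distLe : ∀ {g h g' h' c} → DistLe G (g , h) (g' , h') c → ∣ toℕ g - toℕ g' ∣ ≤ c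
  layer-distLe = distLe-lipschitz (λ (u : Fin N × Fin m) → toℕ (proj₁ u))
                   (lex-lipschitz (Path N) H toℕ (path-lipschitz N))

  unique-< : ∀ (g : Fin N) {p x} → toℕ g ≡ slotLayer (inS p) x → ¬ suc (periodAt p) ∣ x →
             nonMultiples (periodAt p) x < uniques p
  unique-< g {p} g≡ D∤x = nonMultiples-< _ (slotLayer-< N (inS p) (subst (_< N) g≡ (toℕ<n g))) D∤x

  even-layers-apart : ∀ {g h g' h' x x'} → (g , h) ≢ (g' , h') → inS (position h) ≡ true →
                      inS (position h') ≡ true → toℕ g ≡ 2 * x → toℕ g' ≡ 2 * x' →
                      ¬ DistLe G (g , h) (g' , h') 1
  even-layers-apart {g} {h} {g'} {h'} {x} {x'} u≢v h∈S h'∈S g≡2x g'≡2x' dist with toℕ g ≟ toℕ g'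
  ... | no g≢g' = <⇒≱ (≤-trans (multiples-apart 2∣g 2∣g' g≢g') (layer-distLe dist)) (s≤s z≤n)
    where
    2∣g : 2 ∣ toℕ g
    2∣g  = subst (2 ∣_) (sym g≡2x) (m∣m*n x)
    2∣g' : 2 ∣ toℕ g'
    2∣g' = subst (2 ∣_) (sym g'≡2x') (m∣m*n x')
  ... | yes g≡g' with toℕ-injective g≡g'
  ...   | refl = independent-apart (Path N) H (λ h≡h' → u≢v (cong (g ,_) h≡h'))
                   (S-independent h h' (member h h∈S) (member h' h'∈S)) dist
    where
    member : ∀ h → inS (position h) ≡ true → h ∈ S
    member h h∈S = lookup⇒[]= h S (trans (inS-position h) h∈S)

  classes-apart : ∀ {g h g' h' x x'} → (g , h) ≢ (g' , h') → position h ≡ position h' →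
                  toℕ g ≡ slotLayer (inS (position h)) x → toℕ g' ≡ slotLayer (inS (position h')) x' →
                  suc (periodAt (position h)) ∣ x →
                  suc (periodAt (position h')) ∣ x' →
                  ¬ DistLe G (g , h) (g' , h') (suc (suc (position h)))
  classes-apart {g} {h} {g'} {x = x} {x'} u≢v p≡p' g≡ g'≡ D∣x D∣x' dist with partitionIndex-injective S p≡p'
  ... | refl = <⇒≱ (subst (suc (suc (position h)) <_) (cong₂ ∣_-_∣ (sym g≡) (sym g'≡))
                     (slotLayer-apart (inS (position h)) (position h) D∣x D∣x' x≢x'))
                   (layer-distLe dist)
    where
    x≢x' : x ≢ x'
    x≢x' refl = u≢v (cong (_, h) (toℕ-injective (trans g≡ (sym g'≡))))

  1≢2+ : ∀ {c} → 1 ≢ suc (suc c)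
  1≢2+ ()

  class≢unique : ∀ {p p' r} → p < m → suc (suc p) ≢ uniqueColour p' r
  class≢unique p<m eq = m+n≮m _ _ (subst (_< m) (suc-injective (suc-injective eq)) p<m)

  unique-injective : ∀ {p p' r r'} → r < uniques p → r' < uniques p' →
                     uniqueColour p r ≡ uniqueColour p' r' → p ≡ p' × r ≡ r'
  unique-injective {p} {p'} {r} {r'} r< r'< eq =
    p≡p' , +-cancelˡ-≡ (∑ uniques p) _ _ (trans offsets≡ (cong (λ q → ∑ uniques q + r') (sym p≡p')))
    where
    offsets≡ : ∑ uniques p + r ≡ ∑ uniques p' + r'
    offsets≡ = +-cancelˡ-≡ m _ _ (suc-injective (suc-injective eq))
    p≡p' : p ≡ p'
    p≡p' = ∑+-injective uniques r< r'< offsets≡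

  uniques-distinct : ∀ {g h g' h' x x'} → (g , h) ≢ (g' , h') →
                     toℕ g ≡ slotLayer (inS (position h)) x → toℕ g' ≡ slotLayer (inS (position h')) x' →
                     ¬ suc (periodAt (position h)) ∣ x →
                     ¬ suc (periodAt (position h')) ∣ x' →
                     uniqueColour (position h) (nonMultiples (periodAt (position h)) x) ≢
                     uniqueColour (position h') (nonMultiples (periodAt (position h')) x')
  uniques-distinct {g} {h} {g'} {h'} {x} {x'} u≢v g≡ g'≡ D∤x D∤x' eq
    with unique-injective {position h} {position h'} (unique-< g g≡ D∤x) (unique-< g' g'≡ D∤x') eq
  ... | p≡p' , r≡r' with partitionIndex-injective S p≡p'
  ...   | refl = u≢v (cong (_, h) (toℕ-injective (begin
    toℕ g                           ≡⟨ g≡ ⟩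
    slotLayer (inS (position h)) x  ≡⟨ cong (slotLayer _) (nonMultiples-injective _ D∤x D∤x' r≡r') ⟩
    slotLayer (inS (position h)) x' ≡⟨ g'≡ ⟨
    toℕ g'                          ∎)))
    where open ≡-Reasoning

  colour-range : ∀ u → 1 ≤ colour u × colour u ≤ colours
  colour-range (g , h) with colourView (position h) (toℕ g)
  ... | one _ _ _ c≡1 = subst (λ c → 1 ≤ c × c ≤ colours) (sym c≡1) (≤-refl , s≤s z≤n)
  ... | class _ _ _ c≡ = subst (λ c → 1 ≤ c × c ≤ colours) (sym c≡)
                           (s≤s z≤n , s≤s (≤-trans (position-< h) (m≤m+n m _)))
  ... | unique _ g≡ D∤x c≡ = subst (λ c → 1 ≤ c × c ≤ colours) (sym c≡)
                           (s≤s z≤n , s≤s (+-monoʳ-< m (∑+<∑ uniques (position-< h) (unique-< g g≡ D∤x))))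

  colour-packing : ∀ u v → u ≢ v → colour u ≡ colour v → ¬ DistLe G u v (colour u)
  colour-packing (g , h) (g' , h') u≢v same dist
    with colourView (position h) (toℕ g) | colourView (position h') (toℕ g')
  ... | one h∈S x g≡2x c≡1 | one h'∈S x' g'≡2x' _ =
    even-layers-apart {x = x} {x' = x'} u≢v h∈S h'∈S g≡2x g'≡2x' (subst (DistLe G _ _) c≡1 dist)
  ... | one _ _ _ c≡1   | class _ _ _ c'≡  = 1≢2+ (trans (sym c≡1) (trans same c'≡))
  ... | one _ _ _ c≡1   | unique _ _ _ c'≡ = 1≢2+ (trans (sym c≡1) (trans same c'≡))
  ... | class _ _ _ c≡  | one _ _ _ c'≡1   = 1≢2+ (trans (sym c'≡1) (trans (sym same) c≡))
  ... | unique _ _ _ c≡ | one _ _ _ c'≡1   = 1≢2+ (trans (sym c'≡1) (trans (sym same) c≡))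
  ... | class _ _ _ c≡  | unique _ _ _ c'≡ =
    class≢unique {p' = position h'} (position-< h) (trans (sym c≡) (trans same c'≡))
  ... | unique _ _ _ c≡ | class _ _ _ c'≡  =
    class≢unique {p' = position h} (position-< h') (trans (sym c'≡) (trans (sym same) c≡))
  ... | class _ g≡ D∣x c≡ | class _ g'≡ D∣x' c'≡ =
    classes-apart u≢v (suc-injective (suc-injective (trans (sym c≡) (trans same c'≡))))
      g≡ g'≡ D∣x D∣x' (subst (DistLe G _ _) c≡ dist)
  ... | unique _ g≡ D∤x c≡ | unique _ g'≡ D∤x' c'≡ =
    uniques-distinct u≢v g≡ g'≡ D∤x D∤x' (trans (sym c≡) (trans same c'≡))

  packingColouring : HasPackingColoring G colours
  packingColouring = colour , colour-range , colour-packing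

-- Counting the colours

sumFromTo-ℕ : ∀ lo hi {f : ℕ → ℤ} (g : ℕ → ℕ) → (∀ i → f i ≡ ℤ.+ g i) →
              sumFromTo lo hi f ≡ ℤ.+ ∑ (λ t → g (lo + t)) (suc hi ∸ lo)
sumFromTo-ℕ lo hi {f} g f≗g = begin
  foldr ℤ._+_ (ℤ.+ 0) (map (λ t → f (lo + t)) (upTo n))  ≡⟨ foldr-pos (upTo n) ⟩
  ℤ.+ foldr _+_ 0 (map (λ t → g (lo + t)) (upTo n))     ≡⟨ cong (λ xs → ℤ.+ foldr _+_ 0 xs) (map-upTo _ n) ⟩
  ℤ.+ foldr _+_ 0 (applyUpTo (λ t → g (lo + t)) n)      ≡⟨ cong ℤ.+_ (foldr-+-applyUpTo _ n) ⟩
  ℤ.+ ∑ (λ t → g (lo + t)) n                            ∎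
  where
  open ≡-Reasoning
  n : ℕ
  n = suc hi ∸ lo
  foldr-pos : ∀ xs → foldr ℤ._+_ (ℤ.+ 0) (map (λ t → f (lo + t)) xs) ≡
                     ℤ.+ foldr _+_ 0 (map (λ t → g (lo + t)) xs)
  foldr-pos []       = refl
  foldr-pos (x ∷ xs) = cong₂ ℤ._+_ (f≗g (lo + x)) (foldr-pos xs)

-- ℤ division rounds down, so this also holds for n = 0, where n − 1 = −1.
[n-1]/d+1≡ceilDiv : ∀ n e → (ℤ.+ n ℤ.- ℤ.+ 1) ℤ./ℕ suc e ℤ.+ ℤ.+ 1 ≡ ℤ.+ ceilDiv n e
[n-1]/d+1≡ceilDiv zero    zero    = refl
[n-1]/d+1≡ceilDiv zero    (suc e) = cong ℤ.+_ (sym (ceilDiv-zero (suc e)))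
[n-1]/d+1≡ceilDiv (suc n) e       = cong ℤ.+_ (begin
  n / D + 1        ≡⟨ cong (n / D +_) (n/n≡1 D) ⟨
  n / D + D / D    ≡⟨ +-distrib-/-∣ʳ n (∣-refl {D}) ⟨
  (n + D) / D      ≡⟨ /-congˡ (+-suc n e) ⟩
  suc (n + e) / D  ∎)
  where
  open ≡-Reasoning
  D : ℕ
  D = suc e

blockUniques : ℕ → Bool → ℕ → ℕ → ℕ
blockUniques N b o n = ∑ (λ q → nonMultiples (period b (o + q)) (slots N b)) n

blockCeils : ℕ → Bool → ℕ → ℕ → ℕ
blockCeils N b o n = ∑ (λ q → ceilDiv (slots N b) (period b (o + q))) n

blockUniques+blockCeils : ∀ N b o n → blockUniques N b o n + blockCeils N b o n ≡ n * slots N b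
blockUniques+blockCeils N b o n = begin
  blockUniques N b o n + blockCeils N b o n                      ≡⟨ ∑-distrib-+ _ _ n ⟨
  ∑ (λ q → nonMultiples (e q) M + ceilDiv M (e q)) n             ≡⟨ ∑-cong n (λ q _ → nonMultiples+ceilDiv (e q) M) ⟩
  ∑ (λ _ → M) n                                                  ≡⟨ ∑-const M n ⟩
  n * M                                                          ∎
  where
  open ≡-Reasoning
  M : ℕ
  M = slots N b
  e : ℕ → ℕ
  e q = period b (o + q)

∑-columnUniques : ∀ N k a → ∑ (columnUniques N k) (k + a) ≡ blockUniques N false 0 k + blockUniques N true k a
∑-columnUniques N k a = trans (∑-split (columnUniques N k) k a) (cong₂ _+_ (∑-cong k outside) (∑-cong a inside))
  where
  outside : ∀ p → p < k → columnUniques N k p ≡ nonMultiples (period false p) (slots N false)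
  outside p p<k rewrite dec-false (k ≤? p) (<⇒≱ p<k) = refl
  inside : ∀ q → q < a → columnUniques N k (k + q) ≡ nonMultiples (period true (k + q)) (slots N true)
  inside q _ rewrite dec-true (k ≤? k + q) (m≤m+n k q) = refl

lowCeilSum : ∀ N k → sumFromTo 2 (k + 1) (λ i → ℤ.+ ceilDiv N i) ≡ ℤ.+ blockCeils N false 0 k
lowCeilSum N k = trans (sumFromTo-ℕ 2 (k + 1) (ceilDiv N) (λ _ → refl))
                       (cong (ℤ.+_ ∘ ∑ (λ p → ceilDiv N (suc (suc p)))) (m+n∸n≡m k 1))

highCeilSum : ∀ N k a →
              sumFromTo (k + 2) (k + a + 1) (λ j → (ℤ.+ ⌊ N /2⌋ ℤ.- ℤ.+ 1) ℤ./ℕ suc ⌊ j /2⌋ ℤ.+ ℤ.+ 1) ≡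
              ℤ.+ blockCeils N true k a
highCeilSum N k a = trans (sumFromTo-ℕ (k + 2) (k + a + 1) ceil (λ j → [n-1]/d+1≡ceilDiv ⌊ N /2⌋ ⌊ j /2⌋))
                          (cong ℤ.+_ (trans (cong (∑ _) length≡a) (∑-cong a (λ q _ → cong ceil (index q)))))
  where
  ceil : ℕ → ℕ
  ceil j = ceilDiv ⌊ N /2⌋ ⌊ j /2⌋
  index : ∀ q → k + 2 + q ≡ suc (suc (k + q))
  index q = trans (+-assoc k 2 q) (trans (+-suc k (suc q)) (cong suc (+-suc k q)))
  length≡a : suc (k + a + 1) ∸ (k + 2) ≡ a
  length≡a = trans (cong (_∸ (k + 2)) (trans (cong suc (+-comm (k + a) 1)) (sym (index a))))
                   (m+n∸m≡n (k + 2) a)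

N*[k+a]≡blocks : ∀ N k a → N * (k + a) ≡ blockUniques N false 0 k + blockCeils N false 0 k +
                                         (blockUniques N true k a + blockCeils N true k a) + ⌈ N /2⌉ * a
N*[k+a]≡blocks N k a = begin
  N * (k + a)                  ≡⟨ *-distribˡ-+ N k a ⟩
  N * k + N * a                ≡⟨ cong₂ _+_ (*-comm N k) (trans (*-comm N a) (cong (a *_) (sym (⌊n/2⌋+⌈n/2⌉≡n N)))) ⟩
  k * N + a * (F + C)          ≡⟨ cong₂ _+_ (sym (blockUniques+blockCeils N false 0 k)) (*-distribˡ-+ a F C) ⟩
  X + A + (a * F + a * C)      ≡⟨ cong₂ (λ u v → X + A + (u + v)) (sym (blockUniques+blockCeils N true k a)) (*-comm a C) ⟩
  X + A + (Y + B + C * a)      ≡⟨ +-assoc (X + A) (Y + B) (C * a) ⟨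
  X + A + (Y + B) + C * a      ∎
  where
  open ≡-Reasoning
  F C X A Y B : ℕ
  F = ⌊ N /2⌋
  C = ⌈ N /2⌉
  X = blockUniques N false 0 k
  A = blockCeils N false 0 k
  Y = blockUniques N true k a
  B = blockCeils N true k a

bound≡ : ∀ N k a → bound N (k + a) a ≡ ℤ.+ suc (k + a + ∑ (columnUniques N k) (k + a))
bound≡ N k a = begin
  bound N (k + a) a
    ≡⟨ cong₂ (λ A' B' → ℤ.+ (N * (k + a)) ℤ.- ℤ.+ (C * a) ℤ.- A' ℤ.- B' ℤ.+ ℤ.+ (k + a) ℤ.+ ℤ.+ 1)
             (trans (cong (λ k' → sumFromTo 2 (k' + 1) lowTerm) (m+n∸n≡m k a)) (lowCeilSum N k))
             (trans (cong (λ k' → sumFromTo (k' + 2) (k + a + 1) highTerm) (m+n∸n≡m k a)) (highCeilSum N k a)) ⟩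
  ℤ.+ (N * (k + a)) ℤ.- ℤ.+ (C * a) ℤ.- ℤ.+ A ℤ.- ℤ.+ B ℤ.+ ℤ.+ (k + a) ℤ.+ ℤ.+ 1
    ≡⟨ cong (λ z → ℤ.+ z ℤ.- ℤ.+ (C * a) ℤ.- ℤ.+ A ℤ.- ℤ.+ B ℤ.+ ℤ.+ (k + a) ℤ.+ ℤ.+ 1) (N*[k+a]≡blocks N k a) ⟩
  ℤ.+ (X + A + (Y + B) + C * a) ℤ.- ℤ.+ (C * a) ℤ.- ℤ.+ A ℤ.- ℤ.+ B ℤ.+ ℤ.+ (k + a) ℤ.+ ℤ.+ 1
    ≡⟨ cancel (ℤ.+ X) (ℤ.+ A) (ℤ.+ Y) (ℤ.+ B) (ℤ.+ (C * a)) (ℤ.+ (k + a)) ⟩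
  ℤ.+ suc (k + a + (X + Y))
    ≡⟨ cong (λ z → ℤ.+ suc (k + a + z)) (∑-columnUniques N k a) ⟨
  ℤ.+ suc (k + a + ∑ (columnUniques N k) (k + a))
    ∎
  where
  open ≡-Reasoning
  C X A Y B : ℕ
  C = ⌈ N /2⌉
  X = blockUniques N false 0 k
  A = blockCeils N false 0 k
  Y = blockUniques N true k a
  B = blockCeils N true k a
  lowTerm highTerm : ℕ → ℤ
  lowTerm i  = ℤ.+ ceilDiv N i
  highTerm j = (ℤ.+ ⌊ N /2⌋ ℤ.- ℤ.+ 1) ℤ./ℕ suc ⌊ j /2⌋ ℤ.+ ℤ.+ 1
  cancel : ∀ (x a y b c m : ℤ) →
           x ℤ.+ a ℤ.+ (y ℤ.+ b) ℤ.+ c ℤ.- c ℤ.- a ℤ.- b ℤ.+ m ℤ.+ ℤ.+ 1 ≡ ℤ.+ 1 ℤ.+ (m ℤ.+ (x ℤ.+ y))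
  cancel = solve-∀

theorem2p6 : (m : ℕ) (H : SimpleGraph (Fin m)) (a : ℕ) → IsIndependenceNumber H a →
    (n : ℕ) → (χ : ℕ) → IsPackingChromaticNumber (Lex (Path (suc n)) H) χ →
    ℤ.+ χ ℤ.≤ bound (suc n) m a
theorem2p6 m H a ((S , S-independent , ∣S∣≡a) , _) n χ (_ , χ-minimal) =
  subst (ℤ.+ χ ℤ.≤_) (sym bound≡colours) (+≤+ (χ-minimal colours packingColouring))
  where
  open LexPathColouring H S S-independent (suc n)
  k+a≡m : k + a ≡ m
  k+a≡m = trans (cong (k +_) (trans (sym ∣S∣≡a) (∣∣≡count-true S))) (count-false+count-true S)
  bound≡colours : bound (suc n) m a ≡ ℤ.+ colours
  bound≡colours = subst (λ m' → bound (suc n) m' a ≡ ℤ.+ suc (m' + ∑ uniques m')) k+a≡m (bound≡ (suc n) k a)
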